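{- Let $k,n\ge 1$ and $m\ge0$ be integers. For all $a,b\in\{2,\dots,n\}$, $C_k^{(a)}(n,m)=C_k^{(b)}(n,m)$.
   Context: A $k$-cycle of a permutation is a cycle of length exactly $k$ in its disjoint cycle decomposition. $C_k^{(a)}(n,m)$ denotes the number of permutations $\pi\in S_n$ with exactly $m$ $k$-cycles and $\pi(1)=a$. -}

module Defs where

open import Data.Nat using (ℕ; zero; suc; _≟_; _≤_; _≤?_)
open import Data.Fin as Fin using (Fin; toℕ) renaming (_≟_ to _≟ᶠ_)
open import Data.Fin.Properties using (all?; any?)
open import Data.Vec using (Vec; []; _∷_; lookup)
open import Data.List using (List; []; _∷_; concatMap; map; filter; length)
open import Data.List using (allFin)
open import Data.Product using (_×_)
open import Relation.Nullary using (Dec; ¬_; yes; no)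
open import Relation.Nullary.Decidable using (_×-dec_; ¬?)
open import Relation.Unary using (Decidable)
open import Relation.Binary.PropositionalEquality using (_≡_)

-- A function Fin n → Fin n is represented by its table of values
-- (π i = lookup π i).  Elements of Fin n stand for 1,…,n (index 0 is "1").

allVecs : ∀ {A : Set} (xs : List A) (l : ℕ) → List (Vec A l)
allVecs xs zero = [] ∷ []
allVecs xs (suc l) = concatMap (λ x → map (x ∷_) (allVecs xs l)) xs

allFuns : (n : ℕ) → List (Vec (Fin n) n)
allFuns n = allVecs (allFin n) n

IsPerm : ∀ {n} → Vec (Fin n) n → Set
IsPerm {n} π =
  (∀ i j → lookup π i ≡ lookup π j → i ≡ j) ×
  (∀ j → Data.Product.∃ λ i → lookup π i ≡ j)

isPerm? : ∀ {n} → Decidable (IsPerm {n})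
isPerm? π =
  all? (λ i → all? (λ j → dimp (lookup π i ≟ᶠ lookup π j) (i ≟ᶠ j)))
  ×-dec all? (λ j → any? (λ i → lookup π i ≟ᶠ j))
  where
  open import Relation.Nullary.Decidable using (_→-dec_)
  dimp = _→-dec_

allPerms : (n : ℕ) → List (Vec (Fin n) n)
allPerms n = filter isPerm? (allFuns n)

iter : ∀ {n} → Vec (Fin n) n → ℕ → Fin n → Fin n
iter π zero i = i
iter π (suc j) i = lookup π (iter π j i)

-- search for the least j in {s, s+1, …, s+fuel-1} with π^j(i) = i
-- (returns 0 if none)
search : ∀ {n} → Vec (Fin n) n → Fin n → ℕ → ℕ → ℕ
search π i s zero = 0
search π i s (suc fuel) with iter π s i ≟ᶠ i
... | yes _ = s
... | no _ = search π i (suc s) fuel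

-- length of the cycle of π containing i: least j ≥ 1 with π^j(i) = i
-- (such j ≤ n always exists for a permutation)
cycleLen : ∀ {n} → Vec (Fin n) n → Fin n → ℕ
cycleLen {n} π i = search π i 1 n

-- i is the smallest element (in 1..n order) of its cycle under π
-- (the iterates π^0(i), …, π^(n-1)(i) exhaust the cycle of i)
IsCycleMin : ∀ {n} → Vec (Fin n) n → Fin n → Set
IsCycleMin {n} π i = ∀ (j : Fin n) → toℕ i ≤ toℕ (iter π (toℕ j) i)

isCycleMin? : ∀ {n} (π : Vec (Fin n) n) → Decidable (IsCycleMin π)
isCycleMin? π i = all? (λ j → toℕ i ≤? toℕ (iter π (toℕ j) i))

-- number of k-cycles of π: each k-cycle counted once via its least element
numCycles : ∀ {n} → ℕ → Vec (Fin n) n → ℕ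
numCycles {n} k π =
  length (filter (λ i → (cycleLen π i ≟ k) ×-dec isCycleMin? π i) (allFin n))

-- C_k^{(a)}(n+1, m): permutations of {1,…,n+1} with exactly m k-cycles
-- and π(1) = a   (element 1 is index zero of Fin (suc n))
C : (k : ℕ) (n : ℕ) (m : ℕ) (a : Fin (suc n)) → ℕ
C k n m a =
  length (filter (λ π → (numCycles k π ≟ m) ×-dec (lookup π Fin.zero ≟ᶠ a))
                 (allPerms (suc n)))

module Submission where

-- Conjugating by the transposition τ = (c c+1) of two adjacent points other than 1 is an
-- involution on permutations that turns π(1) = c+1 into π(1) = c and preserves cycle lengths.
-- It also preserves the number of k-cycles, which are counted through their least elements:
-- τ preserves the order of every pair except {c, c+1}, so the least elements of the cycles of
-- τπτ are those of π when c and c+1 share a cycle, and their images under τ otherwise.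
-- Hence C is equal on adjacent arguments a ≥ 2, and so constant on {2, …, n}.

open import Defs
open import Algebra.Definitions using (Involutive)
open import Data.Nat using (ℕ; zero; suc; _+_; _*_; _∸_; _≤_; _<_; z≤n; s≤s; s≤s⁻¹; >-nonZero; _≟_)
open import Data.Nat.Properties
  using ( n<1+n; n≤1+n; 1+n≢n; m<n⇒0<n∸m; m∸n≤m; ≤-pred; m+[n∸m]≡n; m∸n+n≡m; m≤m*n; +-comm
        ; ≤-trans; <⇒≤; <-≤-trans; <-irrefl; <⇒≢; ≤∧≢⇒<)
open import Data.Nat.DivMod using (_%_; _/_; m≡m%n+[m/n]*n; m%n<n)
open import Data.Fin using (Fin; zero; suc; toℕ; fromℕ<; inject₁)
open import Data.Fin.Properties
  using (pigeonhole; any?; toℕ-fromℕ<; toℕ<n; toℕ-injective; toℕ-inject₁) renaming (_≟_ to _≟ᶠ_)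
open import Data.Fin.Permutation.Components using (transpose)
open import Data.Vec using (Vec; []; _∷_; lookup; tabulate)
open import Data.Vec.Properties using (lookup∘tabulate; tabulate∘lookup; tabulate-cong)
open import Data.List using (List; []; _∷_; map; filter; length; allFin)
open import Data.List.Properties using (filter-≐)
open import Data.List.Membership.Propositional using (_∈_)
open import Data.List.Membership.Propositional.Properties
  using (∈-map⁺; ∈-map⁻; ∈-concat⁺′; ∈-filter⁺; ∈-filter⁻; ∈-allFin)
open import Data.List.Membership.Propositional.Properties.WithK using (unique∧set⇒bag)
open import Data.List.Relation.Unary.Any using (here; there)
import Data.List.Relation.Unary.All as All
import Data.List.Relation.Unary.All.Properties as All
import Data.List.Relation.Unary.AllPairs as AllPairs
import Data.List.Relation.Unary.AllPairs.Properties as AllPairs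
open import Data.List.Relation.Unary.Unique.Propositional using (Unique)
import Data.List.Relation.Unary.Unique.Propositional.Properties as Unique
open import Data.List.Relation.Binary.Permutation.Propositional using (_↭_; ↭-sym)
open import Data.List.Relation.Binary.Permutation.Propositional.Properties using (filter-↭; ↭-length)
open import Data.List.Relation.Binary.BagAndSetEquality using (∼bag⇒↭)
open import Data.Product using (∃; _×_; _,_; proj₁; proj₂)
open import Data.Product.Function.NonDependent.Propositional using (_×-⇔_)
open import Function using (_∘_; _⇔_; mk⇔; Equivalence)
open import Function.Related.Propositional using (module EquationalReasoning; equivalence; SK-sym; K-refl)
open import Function.Related.TypeIsomorphisms using (¬-cong-⇔)
open import Relation.Nullary using (Dec; yes; no; ¬_; contradiction)
open import Relation.Nullary.Decidable using (_×-dec_; dec-true; dec-false)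
open import Relation.Unary using (Pred; Decidable)
open import Relation.Binary.PropositionalEquality

module _ {a p q} {A : Set a} {P : Pred A p} {Q : Pred A q} (P? : Decidable P) (Q? : Decidable Q) where

  filter-cong-∈ : ∀ xs → (∀ {x} → x ∈ xs → P x ⇔ Q x) → filter P? xs ≡ filter Q? xs
  filter-cong-∈ [] _ = refl
  filter-cong-∈ (x ∷ xs) P⇔Q with P? x | Q? x
  ... | yes _  | yes _  = cong (x ∷_) (filter-cong-∈ xs (P⇔Q ∘ there))
  ... | yes px | no ¬qx = contradiction (Equivalence.to (P⇔Q (here refl)) px) ¬qx
  ... | no ¬px | yes qx = contradiction (Equivalence.from (P⇔Q (here refl)) qx) ¬px
  ... | no _   | no _   = filter-cong-∈ xs (P⇔Q ∘ there)

module _ {a b p} {A : Set a} {B : Set b} {P : Pred B p} (P? : Decidable P) (f : A → B) where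

  length-filter-map : ∀ xs → length (filter P? (map f xs)) ≡ length (filter (P? ∘ f) xs)
  length-filter-map [] = refl
  length-filter-map (x ∷ xs) with P? (f x)
  ... | yes _ = cong suc (length-filter-map xs)
  ... | no _  = length-filter-map xs

involutive⇒injective : ∀ {a} {A : Set a} {σ : A → A} → Involutive _≡_ σ → ∀ {x y} → σ x ≡ σ y → x ≡ y
involutive⇒injective {σ = σ} σ-involutive {x} {y} σx≡σy =
  trans (sym (σ-involutive x)) (trans (cong σ σx≡σy) (σ-involutive y))

module _ {a} {A : Set a} (σ : A → A) (σ-involutive : Involutive _≡_ σ) where

  map-involution-↭ : ∀ {xs} → Unique xs → (∀ {x} → x ∈ xs → σ x ∈ xs) → map σ xs ↭ xs
  map-involution-↭ {xs} xs! σ-closed = ∼bag⇒↭ (unique∧set⇒bag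
    (Unique.map⁺ (involutive⇒injective σ-involutive) xs!)
    xs!
    (λ {x} → mk⇔
      (λ x∈σxs → let (y , y∈xs , x≡σy) = ∈-map⁻ σ x∈σxs in
                 subst (_∈ xs) (sym x≡σy) (σ-closed y∈xs))
      (λ x∈xs → subst (_∈ map σ xs) (σ-involutive x) (∈-map⁺ σ (σ-closed x∈xs)))))

  length-filter-involution : ∀ {p q} {P : Pred A p} {Q : Pred A q} (P? : Decidable P) (Q? : Decidable Q) →
    ∀ {xs} → Unique xs → (∀ {x} → x ∈ xs → σ x ∈ xs) → (∀ {x} → x ∈ xs → P (σ x) ⇔ Q x) →
    length (filter P? xs) ≡ length (filter Q? xs)
  length-filter-involution P? Q? {xs} xs! σ-closed P∘σ⇔Q = begin
    length (filter P? xs)         ≡⟨ ↭-length (filter-↭ P? (↭-sym (map-involution-↭ xs! σ-closed))) ⟩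
    length (filter P? (map σ xs)) ≡⟨ length-filter-map P? σ xs ⟩
    length (filter (P? ∘ σ) xs)   ≡⟨ cong length (filter-cong-∈ (P? ∘ σ) Q? xs P∘σ⇔Q) ⟩
    length (filter Q? xs)         ∎
    where open ≡-Reasoning

module _ {A : Set} (xs : List A) where

  allVecs-complete : (∀ x → x ∈ xs) → ∀ {l} (v : Vec A l) → v ∈ allVecs xs l
  allVecs-complete xs-complete [] = here refl
  allVecs-complete xs-complete {suc l} (x ∷ v) =
    ∈-concat⁺′ (∈-map⁺ (x ∷_) (allVecs-complete xs-complete v))
               (∈-map⁺ (λ y → map (y ∷_) (allVecs xs l)) (xs-complete x))

  allVecs-unique : Unique xs → ∀ l → Unique (allVecs xs l)
  allVecs-unique xs! zero = All.[] AllPairs.∷ AllPairs.[]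
  allVecs-unique xs! (suc l) = Unique.concat⁺
    (All.map⁺ (All.universal (λ _ → Unique.map⁺ (λ { refl → refl }) (allVecs-unique xs! l)) xs))
    (AllPairs.map⁺ (AllPairs.map (λ x≢y {v} (v∈x∷ , v∈y∷) → x≢y (head-≡ v∈x∷ v∈y∷)) xs!))
    where
    head-≡ : ∀ {x y} {vs : List (Vec A l)} {v} → v ∈ map (x ∷_) vs → v ∈ map (y ∷_) vs → x ≡ y
    head-≡ {x} {y} v∈x∷ v∈y∷ with ∈-map⁻ (x ∷_) v∈x∷ | ∈-map⁻ (y ∷_) v∈y∷
    ... | _ , _ , refl | _ , _ , refl = refl

∈-allPerms⁺ : ∀ {n} {π : Vec (Fin n) n} → IsPerm π → π ∈ allPerms n
∈-allPerms⁺ {n} {π} π-perm = ∈-filter⁺ isPerm? (allVecs-complete (allFin n) ∈-allFin π) π-perm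

∈-allPerms⁻ : ∀ {n} {π : Vec (Fin n) n} → π ∈ allPerms n → IsPerm π
∈-allPerms⁻ {n} π∈ = proj₂ (∈-filter⁻ isPerm? {xs = allFuns n} π∈)

allPerms-unique : ∀ n → Unique (allPerms n)
allPerms-unique n = Unique.filter⁺ isPerm? (allVecs-unique (allFin n) (Unique.allFin⁺ n) n)

IsInjective : ∀ {N} → Vec (Fin N) N → Set
IsInjective {N} π = ∀ i j → lookup π i ≡ lookup π j → i ≡ j

Reachable : ∀ {N} → Vec (Fin N) N → Fin N → Fin N → Set
Reachable π x y = ∃ λ t → iter π t x ≡ y

OrbitAbove : ∀ {N} → Vec (Fin N) N → ℕ → Fin N → Set
OrbitAbove π c x = ∀ t → c ≤ toℕ (iter π t x)

KCycleMin : ∀ {N} → ℕ → Vec (Fin N) N → Fin N → Set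
KCycleMin k π i = cycleLen π i ≡ k × IsCycleMin π i

kCycleMin? : ∀ {N} k (π : Vec (Fin N) N) → Decidable (KCycleMin k π)
kCycleMin? k π i = (cycleLen π i ≟ k) ×-dec isCycleMin? π i

kCycleMin-cong : ∀ {N k} {π σ : Vec (Fin N) N} {x y} → cycleLen π x ≡ cycleLen σ y →
  IsCycleMin π x ⇔ IsCycleMin σ y → KCycleMin k π x ⇔ KCycleMin k σ y
kCycleMin-cong lenπx≡lenσy min⇔min = mk⇔ (trans (sym lenπx≡lenσy)) (trans lenπx≡lenσy) ×-⇔ min⇔min

module _ {N} (π : Vec (Fin N) N) where

  iter-+ : ∀ s t x → iter π (s + t) x ≡ iter π s (iter π t x)
  iter-+ zero    t x = refl
  iter-+ (suc s) t x = cong (lookup π) (iter-+ s t x)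

  iter-comm : ∀ s t x → iter π s (iter π t x) ≡ iter π t (iter π s x)
  iter-comm s t x = begin
    iter π s (iter π t x) ≡⟨ iter-+ s t x ⟨
    iter π (s + t) x      ≡⟨ cong (λ u → iter π u x) (+-comm s t) ⟩
    iter π (t + s) x      ≡⟨ iter-+ t s x ⟩
    iter π t (iter π s x) ∎
    where open ≡-Reasoning

  iter-*-periodic : ∀ {p x} → iter π p x ≡ x → ∀ j → iter π (j * p) x ≡ x
  iter-*-periodic πᵖx≡x zero    = refl
  iter-*-periodic {p} {x} πᵖx≡x (suc j) =
    trans (iter-+ p (j * p) x) (trans (cong (iter π p) (iter-*-periodic πᵖx≡x j)) πᵖx≡x)

orbitAbove-reachable : ∀ {N} {π : Vec (Fin N) N} {c x y} →
  Reachable π x y → OrbitAbove π c x → OrbitAbove π c y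
orbitAbove-reachable {π = π} {c} {x} (j , refl) above t = subst (c ≤_) (cong toℕ (iter-+ π t j x)) (above (t + j))

orbitAbove-suc : ∀ {N} {π : Vec (Fin N) N} {x y} →
  OrbitAbove π (suc (toℕ y)) x ⇔ (OrbitAbove π (toℕ y) x × ¬ Reachable π x y)
orbitAbove-suc = mk⇔
  (λ above → (λ t → <⇒≤ (above t)) , λ (t , πᵗx≡y) → <-irrefl (cong toℕ (sym πᵗx≡y)) (above t))
  (λ (above , unreachable) t → ≤∧≢⇒< (above t) (λ y≡πᵗx → unreachable (t , sym (toℕ-injective y≡πᵗx))))

search-cong : ∀ {N} (π σ : Vec (Fin N) N) {x y} → (∀ s → iter π s x ≡ x ⇔ iter σ s y ≡ y) →
  ∀ s fuel → search π x s fuel ≡ search σ y s fuel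
search-cong π σ eqv s zero = refl
search-cong π σ {x} {y} eqv s (suc fuel) with iter π s x ≟ᶠ x | iter σ s y ≟ᶠ y
... | yes _    | yes _     = refl
... | yes πˢx  | no ¬σˢy  = contradiction (Equivalence.to (eqv s) πˢx) ¬σˢy
... | no ¬πˢx  | yes σˢy  = contradiction (Equivalence.from (eqv s) σˢy) ¬πˢx
... | no _     | no _      = search-cong π σ eqv (suc s) fuel

cycleLen-cong : ∀ {N} (π σ : Vec (Fin N) N) {x y} → (∀ s → iter π s x ≡ x ⇔ iter σ s y ≡ y) →
  cycleLen π x ≡ cycleLen σ y
cycleLen-cong {N} π σ eqv = search-cong π σ eqv 1 N

module Orbit {N} (π : Vec (Fin N) N) (π-injective : IsInjective π) where

  iter-injective : ∀ t {x y} → iter π t x ≡ iter π t y → x ≡ y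
  iter-injective zero    eq = eq
  iter-injective (suc t) eq = iter-injective t (π-injective _ _ eq)

  -- By pigeonhole two of x, π x, …, πᴺ x coincide; cancelling the earlier one gives a period.
  periodic : ∀ x → ∃ λ p → 0 < p × p ≤ N × iter π p x ≡ x
  periodic x with pigeonhole (n<1+n N) (λ (j : Fin (suc N)) → iter π (toℕ j) x)
  ... | i , j , i<j , πⁱx≡πʲx = toℕ j ∸ toℕ i , m<n⇒0<n∸m i<j ,
          ≤-trans (m∸n≤m (toℕ j) (toℕ i)) (≤-pred (toℕ<n j)) ,
          iter-injective (toℕ i) (begin
            iter π (toℕ i) (iter π (toℕ j ∸ toℕ i) x) ≡⟨ iter-+ π (toℕ i) _ x ⟨
            iter π (toℕ i + (toℕ j ∸ toℕ i)) x        ≡⟨ cong (λ u → iter π u x) (m+[n∸m]≡n (<⇒≤ i<j)) ⟩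
            iter π (toℕ j) x                          ≡⟨ πⁱx≡πʲx ⟨
            iter π (toℕ i) x                          ∎)
    where open ≡-Reasoning

  iter-reduce : ∀ x t → ∃ λ (r : Fin N) → iter π (toℕ r) x ≡ iter π t x
  iter-reduce x t with periodic x
  ... | p , 0<p , p≤N , πᵖx≡x = fromℕ< r<N , (begin
      iter π (toℕ (fromℕ< r<N)) x      ≡⟨ cong (λ u → iter π u x) (toℕ-fromℕ< r<N) ⟩
      iter π (t % p) x                 ≡⟨ cong (iter π (t % p)) (iter-*-periodic π πᵖx≡x (t / p)) ⟨
      iter π (t % p) (iter π (t / p * p) x) ≡⟨ iter-+ π (t % p) (t / p * p) x ⟨
      iter π (t % p + t / p * p) x     ≡⟨ cong (λ u → iter π u x) (m≡m%n+[m/n]*n t p) ⟨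
      iter π t x                       ∎)
    where
    open ≡-Reasoning
    instance _ = >-nonZero 0<p
    r<N : t % p < N
    r<N = <-≤-trans (m%n<n t p) p≤N

  reachable? : ∀ x y → Dec (Reachable π x y)
  reachable? x y with any? (λ (r : Fin N) → iter π (toℕ r) x ≟ᶠ y)
  ... | yes (r , πʳx≡y) = yes (toℕ r , πʳx≡y)
  ... | no ¬small = no λ (t , πᵗx≡y) →
    let (r , πʳx≡πᵗx) = iter-reduce x t in ¬small (r , trans πʳx≡πᵗx πᵗx≡y)

  reachable-sym : ∀ {x y} → Reachable π x y → Reachable π y x
  reachable-sym {x} (j , refl) with periodic x
  ... | p , 0<p , _ , πᵖx≡x = j * p ∸ j , (begin
      iter π (j * p ∸ j) (iter π j x) ≡⟨ iter-+ π (j * p ∸ j) j x ⟨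
      iter π (j * p ∸ j + j) x        ≡⟨ cong (λ u → iter π u x) (m∸n+n≡m (m≤m*n j p)) ⟩
      iter π (j * p) x                ≡⟨ iter-*-periodic π πᵖx≡x j ⟩
      x                               ∎)
    where
    open ≡-Reasoning
    instance _ = >-nonZero 0<p

  cycleLen-reachable : ∀ {x y} → Reachable π x y → cycleLen π y ≡ cycleLen π x
  cycleLen-reachable {x} (j , refl) = cycleLen-cong π π λ s → mk⇔
    (λ πˢπʲx≡πʲx → iter-injective j (trans (iter-comm π j s x) πˢπʲx≡πʲx))
    (λ πˢx≡x → trans (iter-comm π s j x) (cong (iter π j) πˢx≡x))

  isCycleMin⇔orbitAbove : ∀ {x} → IsCycleMin π x ⇔ OrbitAbove π (toℕ x) x
  isCycleMin⇔orbitAbove {x} = mk⇔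
    (λ min t → let (r , πʳx≡πᵗx) = iter-reduce x t in subst (λ y → toℕ x ≤ toℕ y) πʳx≡πᵗx (min r))
    (λ above r → above (toℕ r))

module Conjugation {N} {τ : Fin N → Fin N} (τ-involutive : Involutive _≡_ τ) where

  τ-injective : ∀ {x y} → τ x ≡ τ y → x ≡ y
  τ-injective = involutive⇒injective τ-involutive

  conj : Vec (Fin N) N → Vec (Fin N) N
  conj π = tabulate (τ ∘ lookup π ∘ τ)

  lookup-conj : ∀ π i → lookup (conj π) i ≡ τ (lookup π (τ i))
  lookup-conj π = lookup∘tabulate (τ ∘ lookup π ∘ τ)

  conj-involutive : Involutive _≡_ conj
  conj-involutive π = begin
    tabulate (τ ∘ lookup (conj π) ∘ τ) ≡⟨ tabulate-cong (λ i → begin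
      τ (lookup (conj π) (τ i))        ≡⟨ cong τ (lookup-conj π (τ i)) ⟩
      τ (τ (lookup π (τ (τ i))))       ≡⟨ τ-involutive _ ⟩
      lookup π (τ (τ i))               ≡⟨ cong (lookup π) (τ-involutive i) ⟩
      lookup π i                       ∎) ⟩
    tabulate (lookup π)                ≡⟨ tabulate∘lookup π ⟩
    π                                  ∎
    where open ≡-Reasoning

  conj-injective : ∀ π → IsInjective π → IsInjective (conj π)
  conj-injective π π-injective i j eq = τ-injective (π-injective _ _ (τ-injective
    (trans (sym (lookup-conj π i)) (trans eq (lookup-conj π j)))))

  conj-isPerm : ∀ π → IsPerm π → IsPerm (conj π)
  conj-isPerm π (π-injective , π-surjective) = conj-injective π π-injective ,
    (λ j → let (i , πi≡τj) = π-surjective (τ j) in τ i , (begin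
      lookup (conj π) (τ i) ≡⟨ lookup-conj π (τ i) ⟩
      τ (lookup π (τ (τ i))) ≡⟨ cong (τ ∘ lookup π) (τ-involutive i) ⟩
      τ (lookup π i)         ≡⟨ cong τ πi≡τj ⟩
      τ (τ j)                ≡⟨ τ-involutive j ⟩
      j                      ∎))
    where open ≡-Reasoning

  iter-conj : ∀ π t x → iter (conj π) t (τ x) ≡ τ (iter π t x)
  iter-conj π zero    x = refl
  iter-conj π (suc t) x = begin
    lookup (conj π) (iter (conj π) t (τ x)) ≡⟨ cong (lookup (conj π)) (iter-conj π t x) ⟩
    lookup (conj π) (τ (iter π t x))        ≡⟨ lookup-conj π _ ⟩
    τ (lookup π (τ (τ (iter π t x))))       ≡⟨ cong (τ ∘ lookup π) (τ-involutive _) ⟩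
    τ (iter π (suc t) x)                    ∎
    where open ≡-Reasoning

  cycleLen-conj : ∀ π x → cycleLen (conj π) (τ x) ≡ cycleLen π x
  cycleLen-conj π x = cycleLen-cong (conj π) π λ s → mk⇔
    (λ eq → τ-injective (trans (sym (iter-conj π s x)) eq))
    (λ eq → trans (iter-conj π s x) (cong τ eq))

  reachable-conj : ∀ π {x y} → Reachable (conj π) (τ x) (τ y) ⇔ Reachable π x y
  reachable-conj π {x} = mk⇔
    (λ (t , eq) → t , τ-injective (trans (sym (iter-conj π t x)) eq))
    (λ (t , eq) → t , trans (iter-conj π t x) (cong τ eq))

module AdjacentTransposition {n} (c : Fin n) where

  p q : Fin (suc n)
  p = inject₁ c
  q = suc c

  toℕ-q : toℕ q ≡ suc (toℕ p)
  toℕ-q = cong suc (sym (toℕ-inject₁ c))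

  p≢q : p ≢ q
  p≢q p≡q = 1+n≢n (sym (trans (cong toℕ p≡q) toℕ-q))

  toℕ-p≢toℕ-q : toℕ p ≢ toℕ q
  toℕ-p≢toℕ-q = p≢q ∘ toℕ-injective

  τ : Fin (suc n) → Fin (suc n)
  τ = transpose p q

  τ-p : τ p ≡ q
  τ-p rewrite dec-true (p ≟ᶠ p) refl = refl

  τ-q : τ q ≡ p
  τ-q rewrite dec-false (q ≟ᶠ p) (p≢q ∘ sym) | dec-true (q ≟ᶠ q) refl = refl

  τ-other : ∀ {x} → x ≢ p → x ≢ q → τ x ≡ x
  τ-other {x} x≢p x≢q rewrite dec-false (x ≟ᶠ p) x≢p | dec-false (x ≟ᶠ q) x≢q = refl

  data Position (x : Fin (suc n)) : Set where
    at-p      : x ≡ p → Position x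
    at-q      : x ≡ q → Position x
    elsewhere : x ≢ p → x ≢ q → Position x

  position : ∀ x → Position x
  position x with x ≟ᶠ p | x ≟ᶠ q
  ... | yes x≡p | _       = at-p x≡p
  ... | no _    | yes x≡q = at-q x≡q
  ... | no x≢p  | no x≢q  = elsewhere x≢p x≢q

  τ-involutive : Involutive _≡_ τ
  τ-involutive x with position x
  ... | at-p refl          = trans (cong τ τ-p) τ-q
  ... | at-q refl          = trans (cong τ τ-q) τ-p
  ... | elsewhere x≢p x≢q = trans (cong τ (τ-other x≢p x≢q)) (τ-other x≢p x≢q)

  -- Only the bound toℕ q separates the adjacent values toℕ p and toℕ q.
  ≤-τ⁻ : ∀ {b} → b ≢ toℕ q → ∀ y → b ≤ toℕ (τ y) → b ≤ toℕ y
  ≤-τ⁻ {b} b≢q y b≤τy with position y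
  ... | at-p refl         = s≤s⁻¹ (subst (b <_) toℕ-q (≤∧≢⇒< (subst (b ≤_) (cong toℕ τ-p) b≤τy) b≢q))
  ... | at-q refl         =
    ≤-trans (subst (b ≤_) (cong toℕ τ-q) b≤τy) (subst (toℕ p ≤_) (sym toℕ-q) (n≤1+n (toℕ p)))
  ... | elsewhere y≢p y≢q = subst (b ≤_) (cong toℕ (τ-other y≢p y≢q)) b≤τy

  ≤-τ : ∀ {b} → b ≢ toℕ q → ∀ y → b ≤ toℕ (τ y) ⇔ b ≤ toℕ y
  ≤-τ b≢q y = mk⇔ (≤-τ⁻ b≢q y)
    (λ b≤y → ≤-τ⁻ b≢q (τ y) (subst (λ z → _ ≤ toℕ z) (sym (τ-involutive y)) b≤y))

  open Conjugation {τ = τ} τ-involutive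

  orbitAbove-conj : ∀ π {b x} → b ≢ toℕ q → OrbitAbove (conj π) b (τ x) ⇔ OrbitAbove π b x
  orbitAbove-conj π {b} {x} b≢q = mk⇔
    (λ above t → Equivalence.to (≤-τ b≢q _) (subst (λ y → b ≤ toℕ y) (iter-conj π t x) (above t)))
    (λ above t → subst (λ y → b ≤ toℕ y) (sym (iter-conj π t x))
                       (Equivalence.from (≤-τ b≢q _) (above t)))

  orbitAbove-q : ∀ {π x} → OrbitAbove π (toℕ q) x ⇔ (OrbitAbove π (toℕ p) x × ¬ Reachable π x p)
  orbitAbove-q rewrite toℕ-q = orbitAbove-suc

  module _ (π : Vec (Fin (suc n)) (suc n)) (π-injective : IsInjective π) where

    private
      module O  = Orbit π π-injective
      module O′ = Orbit (conj π) (conj-injective π π-injective)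

    cycleLen-conj-same-cycle : Reachable π p q → ∀ i → cycleLen (conj π) i ≡ cycleLen π i
    cycleLen-conj-same-cycle p↝q i with position i
    ... | at-p refl = begin
      cycleLen (conj π) p     ≡⟨ cong (cycleLen (conj π)) τ-q ⟨
      cycleLen (conj π) (τ q) ≡⟨ cycleLen-conj π q ⟩
      cycleLen π q            ≡⟨ O.cycleLen-reachable p↝q ⟩
      cycleLen π p            ∎
      where open ≡-Reasoning
    ... | at-q refl = begin
      cycleLen (conj π) q     ≡⟨ cong (cycleLen (conj π)) τ-p ⟨
      cycleLen (conj π) (τ p) ≡⟨ cycleLen-conj π p ⟩
      cycleLen π p            ≡⟨ O.cycleLen-reachable p↝q ⟨
      cycleLen π q            ∎
      where open ≡-Reasoning
    ... | elsewhere i≢p i≢q = trans (cong (cycleLen (conj π)) (sym (τ-other i≢p i≢q))) (cycleLen-conj π i)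

    open EquationalReasoning {k = equivalence}

    isCycleMin-conj-elsewhere : ∀ {i} → i ≢ p → i ≢ q → IsCycleMin (conj π) i ⇔ IsCycleMin π i
    isCycleMin-conj-elsewhere {i} i≢p i≢q = begin
      IsCycleMin (conj π) i            ∼⟨ O′.isCycleMin⇔orbitAbove ⟩
      OrbitAbove (conj π) (toℕ i) i     ≡⟨ cong (OrbitAbove (conj π) (toℕ i)) (sym (τ-other i≢p i≢q)) ⟩
      OrbitAbove (conj π) (toℕ i) (τ i) ∼⟨ orbitAbove-conj π (i≢q ∘ toℕ-injective) ⟩
      OrbitAbove π (toℕ i) i           ∼⟨ SK-sym O.isCycleMin⇔orbitAbove ⟩
      IsCycleMin π i                   ∎

    isCycleMin-conj-p : IsCycleMin (conj π) p ⇔ OrbitAbove π (toℕ p) q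
    isCycleMin-conj-p = begin
      IsCycleMin (conj π) p            ∼⟨ O′.isCycleMin⇔orbitAbove ⟩
      OrbitAbove (conj π) (toℕ p) p     ≡⟨ cong (OrbitAbove (conj π) (toℕ p)) (sym τ-q) ⟩
      OrbitAbove (conj π) (toℕ p) (τ q) ∼⟨ orbitAbove-conj π toℕ-p≢toℕ-q ⟩
      OrbitAbove π (toℕ p) q           ∎

    isCycleMin-conj-q : IsCycleMin (conj π) q ⇔ (IsCycleMin π p × ¬ Reachable π p q)
    isCycleMin-conj-q = begin
      IsCycleMin (conj π) q               ∼⟨ O′.isCycleMin⇔orbitAbove ⟩
      OrbitAbove (conj π) (toℕ q) q        ≡⟨ cong (OrbitAbove (conj π) (toℕ q)) (sym τ-p) ⟩
      OrbitAbove (conj π) (toℕ q) (τ p)    ∼⟨ orbitAbove-q ⟩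
      (OrbitAbove (conj π) (toℕ p) (τ p) × ¬ Reachable (conj π) (τ p) p)
        ≡⟨ cong (λ z → OrbitAbove (conj π) (toℕ p) (τ p) × ¬ Reachable (conj π) (τ p) z) (sym τ-q) ⟩
      (OrbitAbove (conj π) (toℕ p) (τ p) × ¬ Reachable (conj π) (τ p) (τ q))
        ∼⟨ orbitAbove-conj π toℕ-p≢toℕ-q ×-⇔ ¬-cong-⇔ (reachable-conj π) ⟩
      (OrbitAbove π (toℕ p) p × ¬ Reachable π p q)
        ∼⟨ SK-sym O.isCycleMin⇔orbitAbove ×-⇔ K-refl ⟩
      (IsCycleMin π p × ¬ Reachable π p q) ∎

    isCycleMin-q : IsCycleMin π q ⇔ (OrbitAbove π (toℕ p) q × ¬ Reachable π q p)
    isCycleMin-q = begin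
      IsCycleMin π q                   ∼⟨ O.isCycleMin⇔orbitAbove ⟩
      OrbitAbove π (toℕ q) q           ∼⟨ orbitAbove-q ⟩
      (OrbitAbove π (toℕ p) q × ¬ Reachable π q p) ∎

    isCycleMin-conj-same-cycle : Reachable π p q → ∀ i → IsCycleMin (conj π) i ⇔ IsCycleMin π i
    isCycleMin-conj-same-cycle p↝q i with position i
    ... | at-p refl = begin
      IsCycleMin (conj π) p   ∼⟨ isCycleMin-conj-p ⟩
      OrbitAbove π (toℕ p) q
        ∼⟨ mk⇔ (orbitAbove-reachable (O.reachable-sym p↝q)) (orbitAbove-reachable p↝q) ⟩
      OrbitAbove π (toℕ p) p  ∼⟨ SK-sym O.isCycleMin⇔orbitAbove ⟩
      IsCycleMin π p          ∎
    ... | at-q refl = mk⇔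
      (λ min′ → contradiction p↝q (proj₂ (Equivalence.to isCycleMin-conj-q min′)))
      (λ min → contradiction (O.reachable-sym p↝q) (proj₂ (Equivalence.to isCycleMin-q min)))
    ... | elsewhere i≢p i≢q = isCycleMin-conj-elsewhere i≢p i≢q

    isCycleMin-conj-different-cycles : ¬ Reachable π p q → ∀ i → IsCycleMin (conj π) (τ i) ⇔ IsCycleMin π i
    isCycleMin-conj-different-cycles p↛q i with position i
    ... | at-p refl = begin
      IsCycleMin (conj π) (τ p)            ≡⟨ cong (IsCycleMin (conj π)) τ-p ⟩
      IsCycleMin (conj π) q                ∼⟨ isCycleMin-conj-q ⟩
      (IsCycleMin π p × ¬ Reachable π p q) ∼⟨ mk⇔ proj₁ (_, p↛q) ⟩
      IsCycleMin π p                       ∎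
    ... | at-q refl = begin
      IsCycleMin (conj π) (τ q)                     ≡⟨ cong (IsCycleMin (conj π)) τ-q ⟩
      IsCycleMin (conj π) p                         ∼⟨ isCycleMin-conj-p ⟩
      OrbitAbove π (toℕ p) q                        ∼⟨ mk⇔ (_, p↛q ∘ O.reachable-sym) proj₁ ⟩
      (OrbitAbove π (toℕ p) q × ¬ Reachable π q p)  ∼⟨ SK-sym isCycleMin-q ⟩
      IsCycleMin π q                                ∎
    ... | elsewhere i≢p i≢q = begin
      IsCycleMin (conj π) (τ i) ≡⟨ cong (IsCycleMin (conj π)) (τ-other i≢p i≢q) ⟩
      IsCycleMin (conj π) i     ∼⟨ isCycleMin-conj-elsewhere i≢p i≢q ⟩
      IsCycleMin π i            ∎

    numCycles-conj : ∀ k → numCycles k (conj π) ≡ numCycles k π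
    numCycles-conj k with O.reachable? p q
    ... | yes p↝q = cong length (filter-≐ (kCycleMin? k (conj π)) (kCycleMin? k π)
      ((λ {i} → Equivalence.to (same i)) , (λ {i} → Equivalence.from (same i))) (allFin (suc n)))
      where
      same : ∀ i → KCycleMin k (conj π) i ⇔ KCycleMin k π i
      same i = kCycleMin-cong (cycleLen-conj-same-cycle p↝q i) (isCycleMin-conj-same-cycle p↝q i)
    ... | no p↛q = length-filter-involution τ τ-involutive (kCycleMin? k (conj π)) (kCycleMin? k π)
      (Unique.allFin⁺ (suc n)) (λ _ → ∈-allFin _)
      (λ {i} _ → kCycleMin-cong (cycleLen-conj π i) (isCycleMin-conj-different-cycles p↛q i))

C-adjacent : ∀ k {n} m (c : Fin n) → 1 ≤ toℕ c → C k n m (inject₁ c) ≡ C k n m (suc c)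
C-adjacent k {n} m c 1≤c = length-filter-involution conj conj-involutive (counted? p) (counted? q)
  (allPerms-unique (suc n)) (λ {π} π∈ → ∈-allPerms⁺ (conj-isPerm π (∈-allPerms⁻ π∈))) conj-counted
  where
  open AdjacentTransposition c
  open Conjugation {τ = τ} τ-involutive

  counted? : ∀ a (π : Vec (Fin (suc n)) (suc n)) → Dec (numCycles k π ≡ m × lookup π zero ≡ a)
  counted? a π = (numCycles k π ≟ m) ×-dec (lookup π zero ≟ᶠ a)

  τ-zero : τ zero ≡ zero
  τ-zero = τ-other (λ 0≡p → <⇒≢ 1≤c (trans (cong toℕ 0≡p) (toℕ-inject₁ c))) (λ ())

  conj-counted : ∀ {π} → π ∈ allPerms (suc n) →
    (numCycles k (conj π) ≡ m × lookup (conj π) zero ≡ p) ⇔ (numCycles k π ≡ m × lookup π zero ≡ q)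
  conj-counted {π} π∈ =
    mk⇔ (trans (sym numCycles-preserved)) (trans numCycles-preserved) ×-⇔
    mk⇔ (λ π′0≡p → τ-injective (trans (sym lookup-conj-zero) (trans π′0≡p (sym τ-q))))
        (λ π0≡q → trans lookup-conj-zero (trans (cong τ π0≡q) τ-q))
    where
    numCycles-preserved : numCycles k (conj π) ≡ numCycles k π
    numCycles-preserved = numCycles-conj π (proj₁ (∈-allPerms⁻ π∈)) k
    lookup-conj-zero : lookup (conj π) zero ≡ τ (lookup π zero)
    lookup-conj-zero = trans (lookup-conj π zero) (cong (τ ∘ lookup π) τ-zero)

adjacent-≡⇒≡-zero : ∀ {a} {A : Set a} {n} (f : Fin (suc n) → A) →
  (∀ i → f (inject₁ i) ≡ f (suc i)) → ∀ i → f i ≡ f zero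
adjacent-≡⇒≡-zero f adjacent-≡ zero = refl
adjacent-≡⇒≡-zero {n = suc n} f adjacent-≡ (suc i) =
  trans (sym (adjacent-≡ i)) (adjacent-≡⇒≡-zero (f ∘ inject₁) (adjacent-≡ ∘ inject₁) i)

proposition2p5 : (k n m : ℕ) → 1 ≤ k → (a b : Fin (suc n)) → 1 ≤ toℕ a → 1 ≤ toℕ b →
    C k n m a ≡ C k n m b
proposition2p5 k (suc n) m _ (suc a) (suc b) _ _ = trans (C≡C₂ a) (sym (C≡C₂ b))
  where
  C≡C₂ : ∀ a → C k (suc n) m (suc a) ≡ C k (suc n) m (suc zero)
  C≡C₂ = adjacent-≡⇒≡-zero (C k (suc n) m ∘ suc) (λ i → C-adjacent k m (suc i) (s≤s z≤n))
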